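{- Let $G=(V,E)$ be a simple graph and let $v\in V$ be a pendant vertex (i.e. $\deg(v)=1$) with $uv\in E$. Then $$\gamma_{\rm st}(G)-1\leq \gamma_{\rm st}(G/v)\leq \gamma_{\rm st}(G)+\deg(u)-1.$$ Furthermore, these bounds are tight: each of the two inequalities holds with equality for some such graph $G$ and pendant vertex $v$.
   Context: For a simple graph $H$, a set $D\subseteq V(H)$ is a strong dominating set of $H$ if for every vertex $x\in V(H)\setminus D$ there is a vertex $y\in D$ with $xy\in E(H)$ and $\deg_H(x)\leq \deg_H(y)$. The strong domination number $\gamma_{\rm st}(H)$ is the minimum cardinality of a strong dominating set of $H$. The contraction of a vertex $v$ in $G$, denoted $G/v$, is the graph obtained from $G$ by deleting $v$ (and its incident edges) and adding edges so that the open neighbourhood $N(v)$ of $v$ induces a clique (for a pendant vertex this is simply $G-v$). $\deg(u)$ is the degree of $u$ in $G$. -}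

module Defs where

open import Data.Nat using (ℕ; suc; _≤_)
open import Data.Bool using (Bool; true; false; _∨_; _∧_; not)
open import Data.Bool.Properties using (∧-comm)
open import Data.Fin using (Fin; punchIn)
open import Data.Fin.Properties using (_≟_)
open import Data.Fin.Subset using (Subset; _∈_; _∉_; ∣_∣)
open import Data.Vec using (tabulate)
open import Data.Product using (Σ; _×_; _,_)
open import Data.Empty using (⊥-elim)
open import Relation.Nullary.Decidable using (⌊_⌋; yes; no)
open import Relation.Binary.PropositionalEquality using (_≡_; refl; sym; cong₂)
import Relation.Binary.PropositionalEquality

record Graph (n : ℕ) : Set where
  field
    adj    : Fin n → Fin n → Bool
    adj-sym    : ∀ x y → adj x y ≡ adj y x
    adj-irrefl : ∀ x → adj x x ≡ false
open Graph public

N : ∀ {n} → Graph n → Fin n → Subset n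
N G x = tabulate (λ y → adj G x y)

deg : ∀ {n} → Graph n → Fin n → ℕ
deg G x = ∣ N G x ∣

IsStrongDominating : ∀ {n} → Graph n → Subset n → Set
IsStrongDominating {n} G D =
  ∀ (x : Fin n) → x ∉ D →
    Σ (Fin n) λ y → y ∈ D × adj G x y ≡ true × deg G x ≤ deg G y

IsStrongDomNumber : ∀ {n} → Graph n → ℕ → Set
IsStrongDomNumber {n} G k =
  (Σ (Subset n) λ D → IsStrongDominating G D × ∣ D ∣ ≡ k)
  × (∀ (D : Subset n) → IsStrongDominating G D → k ≤ ∣ D ∣)

-- Contraction G/v: delete v (remaining vertices indexed via punchIn v),
-- and make N(v) a clique.
private
  eqb : ∀ {n} → Fin n → Fin n → Bool
  eqb x y = ⌊ x ≟ y ⌋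

  eqb-sym : ∀ {n} (x y : Fin n) → eqb x y ≡ eqb y x
  eqb-sym x y with x ≟ y | y ≟ x
  ... | yes _ | yes _ = refl
  ... | no _  | no _  = refl
  ... | yes p | no q  = ⊥-elim (q (sym p))
  ... | no p  | yes q = ⊥-elim (p (sym q))

  eqb-refl : ∀ {n} (x : Fin n) → eqb x x ≡ true
  eqb-refl x with x ≟ x
  ... | yes _ = refl
  ... | no p  = ⊥-elim (p refl)

contract : ∀ {n} → Graph (suc n) → Fin (suc n) → Graph n
contract {n} G v = record { adj = a ; adj-sym = s ; adj-irrefl = i }
  where
  a : Fin n → Fin n → Bool
  a x y = adj G (punchIn v x) (punchIn v y)
          ∨ (not (eqb x y) ∧ (adj G v (punchIn v x) ∧ adj G v (punchIn v y)))
  s : ∀ x y → a x y ≡ a y x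
  s x y = cong₂ _∨_ (adj-sym G (punchIn v x) (punchIn v y))
            (cong₂ _∧_ (Relation.Binary.PropositionalEquality.cong not (eqb-sym x y))
              (∧-comm (adj G v (punchIn v x)) (adj G v (punchIn v y))))
  i : ∀ x → a x x ≡ false
  i x rewrite adj-irrefl G (punchIn v x) | eqb-refl x = refl

-- A pendant vertex v has the single neighbour u, so making N(v) a clique adds no edge: G/v is
-- G − v, and every vertex other than u keeps its degree (u loses one). Adding u to a strong
-- dominating set of G/v gives one of G, since u dominates v (deg v = 1 ≤ deg u). Conversely,
-- for a strong dominating set D of G, (D ∪ N[u]) − v strongly dominates G/v: a vertex outside
-- N[u] has a dominator in D that is neither v nor u, so the degrees are unchanged. D meets
-- N[u] (in u, or in v when v ∈ D) and v ∈ N[u] is discarded, which bounds the size by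
-- |D| + deg u − 1. The paths P₄ and P₂, contracted at an end vertex, attain the two bounds.
module Submission where

open import Defs
open import Data.Nat using (ℕ; zero; suc; _≤_; _<_; _+_; _∸_; z≤n; s≤s; s≤s⁻¹; _≡ᵇ_)
open import Data.Nat.Properties
  using (≤-refl; ≤-trans; n≤1+n; +-comm; +-monoʳ-<; module ≤-Reasoning; ≤-reflexive; <-≤-trans; +-suc; +-monoʳ-≤; ∸-monoˡ-≤; <-irrefl)
open import Data.Bool using (Bool; true; false; _∨_; _∧_; not)
open import Data.Bool.Properties using (∨-comm; ∨-identityʳ)
open import Data.Fin using (Fin; zero; suc; toℕ; punchIn; punchOut)
open import Data.Fin.Properties using (_≟_; punchIn-punchOut; punchIn-injective)
open import Data.Fin.Subset using (Subset; _∈_; _∉_; _⊆_; _∪_; ⁅_⁆; _-_; ∣_∣; inside; outside)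
open import Data.Fin.Subset.Properties
  using (∣⁅x⁆∣≡1; x∈⁅x⁆; x∈⁅y⁆⇒x≡y; x≢y⇒x∉⁅y⁆; p⊆q⇒∣p∣≤∣q∣; p⊂q⇒∣p∣<∣q∣;
         x∈p∪q⁺; x∈p∪q⁻; x∈p∧x∉q⇒x∈p─q; x∈p⇒∣p-x∣<∣p∣; _∈?_)
open import Data.Vec using (_∷_; []; tabulate; lookup; insertAt; removeAt; here; there)
open import Data.Vec.Properties
  using ([]=⇒lookup; lookup⇒[]=; lookup∘tabulate; tabulate-cong; insertAt-removeAt)
open import Data.Product using (Σ; _×_; _,_)
open import Data.Sum using (_⊎_; inj₁; inj₂)
open import Function using (_∘_)
open import Relation.Nullary using (yes; no; contradiction)
open import Relation.Nullary.Decidable using (⌊_⌋)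
open import Relation.Binary.PropositionalEquality

private
  variable
    n : ℕ

x∈p⇒⁅x⁆⊆p : {x : Fin n} {p : Subset n} → x ∈ p → ⁅ x ⁆ ⊆ p
x∈p⇒⁅x⁆⊆p {x = x} x∈p y∈⁅x⁆ = subst (_∈ _) (sym (x∈⁅y⁆⇒x≡y x y∈⁅x⁆)) x∈p

x∈p⇒0<∣p∣ : {x : Fin n} {p : Subset n} → x ∈ p → 0 < ∣ p ∣
x∈p⇒0<∣p∣ {x = x} x∈p = <-≤-trans (≤-reflexive (sym (∣⁅x⁆∣≡1 x))) (p⊆q⇒∣p∣≤∣q∣ (x∈p⇒⁅x⁆⊆p x∈p))

x∈p∧y∈p∧x≢y⇒1<∣p∣ : {x y : Fin n} {p : Subset n} → x ∈ p → y ∈ p → x ≢ y → 1 < ∣ p ∣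
x∈p∧y∈p∧x≢y⇒1<∣p∣ {x = x} {y} x∈p y∈p x≢y = <-≤-trans (≤-reflexive (cong suc (sym (∣⁅x⁆∣≡1 x))))
  (p⊂q⇒∣p∣<∣q∣ (x∈p⇒⁅x⁆⊆p x∈p , y , y∈p , x≢y ∘ sym ∘ x∈⁅y⁆⇒x≡y x))

∣p∪q∣≤∣p∣+∣q∣ : (p q : Subset n) → ∣ p ∪ q ∣ ≤ ∣ p ∣ + ∣ q ∣
∣p∪q∣≤∣p∣+∣q∣ []            []            = z≤n
∣p∪q∣≤∣p∣+∣q∣ (outside ∷ p) (outside ∷ q) = ∣p∪q∣≤∣p∣+∣q∣ p q
∣p∪q∣≤∣p∣+∣q∣ (outside ∷ p) (inside  ∷ q) =
  ≤-trans (s≤s (∣p∪q∣≤∣p∣+∣q∣ p q)) (≤-reflexive (sym (+-suc ∣ p ∣ ∣ q ∣)))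
∣p∪q∣≤∣p∣+∣q∣ (inside  ∷ p) (outside ∷ q) = s≤s (∣p∪q∣≤∣p∣+∣q∣ p q)
∣p∪q∣≤∣p∣+∣q∣ (inside  ∷ p) (inside  ∷ q) =
  s≤s (≤-trans (∣p∪q∣≤∣p∣+∣q∣ p q) (+-monoʳ-≤ ∣ p ∣ (n≤1+n ∣ q ∣)))

x∈p∩q⇒∣p∪q∣<∣p∣+∣q∣ : {x : Fin n} (p q : Subset n) → x ∈ p → x ∈ q → ∣ p ∪ q ∣ < ∣ p ∣ + ∣ q ∣
x∈p∩q⇒∣p∪q∣<∣p∣+∣q∣ {x = x} p q x∈p x∈q = begin-strict
  ∣ p ∪ q ∣       ≤⟨ p⊆q⇒∣p∣≤∣q∣ p∪q⊆p∪[q-x] ⟩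
  ∣ p ∪ (q - x) ∣ ≤⟨ ∣p∪q∣≤∣p∣+∣q∣ p (q - x) ⟩
  ∣ p ∣ + ∣ q - x ∣ <⟨ +-monoʳ-< ∣ p ∣ (x∈p⇒∣p-x∣<∣p∣ x∈q) ⟩
  ∣ p ∣ + ∣ q ∣   ∎
  where
  open ≤-Reasoning
  p∪q⊆p∪[q-x] : p ∪ q ⊆ p ∪ (q - x)
  p∪q⊆p∪[q-x] {y} y∈p∪q with x∈p∪q⁻ p q y∈p∪q | y ≟ x
  ... | inj₁ y∈p | _     = x∈p∪q⁺ (inj₁ y∈p)
  ... | inj₂ _   | yes refl = x∈p∪q⁺ (inj₁ x∈p)
  ... | inj₂ y∈q | no y≢x = x∈p∪q⁺ (inj₂ (x∈p∧x∉q⇒x∈p─q y∈q (x≢y⇒x∉⁅y⁆ y≢x)))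

∣insertAt-outside∣ : (p : Subset n) (i : Fin (suc n)) → ∣ insertAt p i outside ∣ ≡ ∣ p ∣
∣insertAt-outside∣ p             zero    = refl
∣insertAt-outside∣ (outside ∷ p) (suc i) = ∣insertAt-outside∣ p i
∣insertAt-outside∣ (inside  ∷ p) (suc i) = cong suc (∣insertAt-outside∣ p i)

∣insertAt-inside∣ : (p : Subset n) (i : Fin (suc n)) → ∣ insertAt p i inside ∣ ≡ suc ∣ p ∣
∣insertAt-inside∣ p             zero    = refl
∣insertAt-inside∣ (outside ∷ p) (suc i) = ∣insertAt-inside∣ p i
∣insertAt-inside∣ (inside  ∷ p) (suc i) = cong suc (∣insertAt-inside∣ p i)

∣p∣≤∣insertAt∣ : (p : Subset n) (i : Fin (suc n)) (b : Bool) → ∣ p ∣ ≤ ∣ insertAt p i b ∣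
∣p∣≤∣insertAt∣ p i outside = ≤-reflexive (sym (∣insertAt-outside∣ p i))
∣p∣≤∣insertAt∣ p i inside  = ≤-trans (n≤1+n ∣ p ∣) (≤-reflexive (sym (∣insertAt-inside∣ p i)))

i∈p⇒∣p∣≡1+∣removeAt∣ : {i : Fin (suc n)} (p : Subset (suc n)) → i ∈ p → ∣ p ∣ ≡ suc ∣ removeAt p i ∣
i∈p⇒∣p∣≡1+∣removeAt∣ {i = i} p i∈p = begin
  ∣ p ∣                                      ≡⟨ cong ∣_∣ (sym (insertAt-removeAt p i)) ⟩
  ∣ insertAt (removeAt p i) i (lookup p i) ∣ ≡⟨ cong (λ b → ∣ insertAt (removeAt p i) i b ∣) ([]=⇒lookup i∈p) ⟩
  ∣ insertAt (removeAt p i) i inside ∣       ≡⟨ ∣insertAt-inside∣ (removeAt p i) i ⟩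
  suc ∣ removeAt p i ∣                       ∎
  where open ≡-Reasoning

∈-insertAt⁺ : {x : Fin n} {p : Subset n} (i : Fin (suc n)) (b : Bool) → x ∈ p → punchIn i x ∈ insertAt p i b
∈-insertAt⁺ zero    b x∈p         = there x∈p
∈-insertAt⁺ (suc i) b here        = here
∈-insertAt⁺ (suc i) b (there x∈p) = there (∈-insertAt⁺ i b x∈p)

∈-removeAt⁺ : {x : Fin n} (p : Subset (suc n)) (i : Fin (suc n)) → punchIn i x ∈ p → x ∈ removeAt p i
∈-removeAt⁺                     (_ ∷ _)         zero    (there x∈p) = x∈p
∈-removeAt⁺ {x = zero}          (_ ∷ _ ∷ _)     (suc i) here        = here
∈-removeAt⁺ {x = suc x}         (_ ∷ p@(_ ∷ _)) (suc i) (there x∈p) = there (∈-removeAt⁺ p i x∈p)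

tabulate-insertAt : (f : Fin (suc n) → Bool) (i : Fin (suc n)) →
                    tabulate f ≡ insertAt (tabulate (f ∘ punchIn i)) i (f i)
tabulate-insertAt             f zero    = refl
tabulate-insertAt {n = suc n} f (suc i) = cong (f zero ∷_) (tabulate-insertAt (f ∘ suc) i)

data PunchInView (i : Fin (suc n)) : Fin (suc n) → Set where
  hole    : PunchInView i i
  punched : (j : Fin n) → PunchInView i (punchIn i j)

punchInView : (i j : Fin (suc n)) → PunchInView i j
punchInView i j with i ≟ j
... | yes refl = hole
... | no i≢j   = subst (PunchInView i) (punchIn-punchOut i≢j) (punched (punchOut i≢j))

adj⇒∈N : (G : Graph n) {x y : Fin n} → adj G x y ≡ true → y ∈ N G x
adj⇒∈N G {x} {y} xy = lookup⇒[]= y (N G x) (trans (lookup∘tabulate (adj G x) y) xy)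

closedN : Graph n → Fin n → Subset n
closedN G x = ⁅ x ⁆ ∪ N G x

∣closedN∣≤1+deg : (G : Graph n) (x : Fin n) → ∣ closedN G x ∣ ≤ suc (deg G x)
∣closedN∣≤1+deg G x = ≤-trans (∣p∪q∣≤∣p∣+∣q∣ ⁅ x ⁆ (N G x)) (≤-reflexive (cong (_+ deg G x) (∣⁅x⁆∣≡1 x)))

x∈closedN[x] : (G : Graph n) (x : Fin n) → x ∈ closedN G x
x∈closedN[x] G x = x∈p∪q⁺ (inj₁ (x∈⁅x⁆ x))

adj⇒∈closedN : (G : Graph n) {x y : Fin n} → adj G x y ≡ true → y ∈ closedN G x
adj⇒∈closedN G xy = x∈p∪q⁺ (inj₂ (adj⇒∈N G xy))

NeighbourhoodSubsingleton : Graph n → Fin n → Set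
NeighbourhoodSubsingleton G v = ∀ a b → adj G v a ≡ true → adj G v b ≡ true → a ≡ b

module ContractAtSubsingleton (G : Graph (suc n)) (v : Fin (suc n)) (N[v]-sub : NeighbourhoodSubsingleton G v) where

  contract-adj : ∀ x y → adj (contract G v) x y ≡ adj G (punchIn v x) (punchIn v y)
  contract-adj = unfolded
    where
    -- the adjacency of contract G v, with Defs' private eqb x y written out as ⌊ x ≟ y ⌋
    unfolded : ∀ x y → adj G (punchIn v x) (punchIn v y)
                         ∨ (not ⌊ x ≟ y ⌋ ∧ (adj G v (punchIn v x) ∧ adj G v (punchIn v y)))
                       ≡ adj G (punchIn v x) (punchIn v y)
    unfolded x y with x ≟ y
    ... | yes refl = ∨-identityʳ _
    ... | no x≢y with adj G v (punchIn v x) in vx | adj G v (punchIn v y) in vy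
    ...   | false | _     = ∨-identityʳ _
    ...   | true  | false = ∨-identityʳ _
    ...   | true  | true  = contradiction (punchIn-injective v x y (N[v]-sub _ _ vx vy)) x≢y

  N-punchIn : ∀ x → N G (punchIn v x) ≡ insertAt (N (contract G v) x) v (adj G (punchIn v x) v)
  N-punchIn x = trans (tabulate-insertAt (adj G (punchIn v x)) v)
    (cong (λ p → insertAt p v (adj G (punchIn v x) v)) (tabulate-cong (sym ∘ contract-adj x)))

  deg-contract≤deg : ∀ x → deg (contract G v) x ≤ deg G (punchIn v x)
  deg-contract≤deg x = subst (deg (contract G v) x ≤_) (cong ∣_∣ (sym (N-punchIn x)))
    (∣p∣≤∣insertAt∣ (N (contract G v) x) v (adj G (punchIn v x) v))

  deg-contract≡deg : ∀ x → adj G (punchIn v x) v ≡ false → deg (contract G v) x ≡ deg G (punchIn v x)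
  deg-contract≡deg x xv = sym (begin
    deg G (punchIn v x)                            ≡⟨ cong ∣_∣ (N-punchIn x) ⟩
    ∣ insertAt (N C x) v (adj G (punchIn v x) v) ∣ ≡⟨ cong (λ b → ∣ insertAt (N C x) v b ∣) xv ⟩
    ∣ insertAt (N C x) v outside ∣                 ≡⟨ ∣insertAt-outside∣ (N C x) v ⟩
    deg C x                                        ∎)
    where
    open ≡-Reasoning
    C : Graph n
    C = contract G v

module Pendant (G : Graph (suc n)) (v u : Fin (suc n)) (deg[v]≡1 : deg G v ≡ 1) (uv : adj G u v ≡ true) where

  C : Graph n
  C = contract G v

  vu : adj G v u ≡ true
  vu = trans (adj-sym G v u) uv

  neighbour-unique : ∀ w → adj G v w ≡ true → w ≡ u
  neighbour-unique w vw with w ≟ u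
  ... | yes w≡u = w≡u
  ... | no  w≢u = contradiction (subst (1 <_) deg[v]≡1
                    (x∈p∧y∈p∧x≢y⇒1<∣p∣ (adj⇒∈N G vw) (adj⇒∈N G vu) w≢u)) (<-irrefl refl)

  N[v]-subsingleton : NeighbourhoodSubsingleton G v
  N[v]-subsingleton a b va vb = trans (neighbour-unique a va) (sym (neighbour-unique b vb))

  open ContractAtSubsingleton G v N[v]-subsingleton

  adj-v≡false : ∀ w → w ≢ u → adj G w v ≡ false
  adj-v≡false w w≢u with adj G w v in wv
  ... | false = refl
  ... | true  = contradiction (neighbour-unique w (trans (adj-sym G v w) wv)) w≢u

  deg-contract≡ : ∀ x → punchIn v x ≢ u → deg C x ≡ deg G (punchIn v x)
  deg-contract≡ x x≢u = deg-contract≡deg x (adj-v≡false (punchIn v x) x≢u)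

  lift : Subset n → Subset (suc n)
  lift D′ = insertAt D′ v outside ∪ ⁅ u ⁆

  ∣lift∣≤1+∣D′∣ : (D′ : Subset n) → ∣ lift D′ ∣ ≤ suc ∣ D′ ∣
  ∣lift∣≤1+∣D′∣ D′ = ≤-trans (∣p∪q∣≤∣p∣+∣q∣ (insertAt D′ v outside) ⁅ u ⁆)
    (≤-reflexive (trans (cong₂ _+_ (∣insertAt-outside∣ D′ v) (∣⁅x⁆∣≡1 u)) (+-comm ∣ D′ ∣ 1)))

  lift-dominating : (D′ : Subset n) → IsStrongDominating C D′ → IsStrongDominating G (lift D′)
  lift-dominating D′ D′-dom x x∉D with punchInView v x
  ... | hole = u , x∈p∪q⁺ (inj₂ (x∈⁅x⁆ u)) , vu ,
               subst (_≤ deg G u) (sym deg[v]≡1) (x∈p⇒0<∣p∣ (adj⇒∈N G uv))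
  ... | punched x′ with D′-dom x′ (x∉D ∘ x∈p∪q⁺ ∘ inj₁ ∘ ∈-insertAt⁺ v outside)
  ...   | y′ , y′∈D′ , x′y′ , x′≤y′ =
    punchIn v y′ , x∈p∪q⁺ (inj₁ (∈-insertAt⁺ v outside y′∈D′)) ,
    trans (sym (contract-adj x′ y′)) x′y′ ,
    (begin
      deg G (punchIn v x′) ≡⟨ sym (deg-contract≡ x′ x≢u) ⟩
      deg C x′             ≤⟨ x′≤y′ ⟩
      deg C y′             ≤⟨ deg-contract≤deg y′ ⟩
      deg G (punchIn v y′) ∎)
    where
    open ≤-Reasoning
    x≢u : punchIn v x′ ≢ u
    x≢u refl = x∉D (x∈p∪q⁺ (inj₂ (x∈⁅x⁆ u)))

  restrict : Subset (suc n) → Subset n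
  restrict D = removeAt (D ∪ closedN G u) v

  dominated-outside-closedN : (D : Subset (suc n)) → IsStrongDominating G D →
    ∀ x′ → punchIn v x′ ∉ D → punchIn v x′ ∉ closedN G u →
    Σ (Fin n) λ y′ → punchIn v y′ ∈ D × adj C x′ y′ ≡ true × deg C x′ ≤ deg C y′
  dominated-outside-closedN D D-dom x′ x∉D x∉N[u] with D-dom (punchIn v x′) x∉D
  ... | y , y∈D , xy , x≤y with punchInView v y
  ...   | hole = contradiction (neighbour-unique _ (trans (adj-sym G v _) xy))
                   (λ where refl → x∉N[u] (x∈closedN[x] G u))
  ...   | punched y′ = y′ , y∈D , trans (contract-adj x′ y′) xy ,
    (begin
      deg C x′             ≡⟨ deg-contract≡ x′ x≢u ⟩
      deg G (punchIn v x′) ≤⟨ x≤y ⟩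
      deg G (punchIn v y′) ≡⟨ sym (deg-contract≡ y′ y≢u) ⟩
      deg C y′             ∎)
    where
    open ≤-Reasoning
    x≢u : punchIn v x′ ≢ u
    x≢u refl = x∉N[u] (x∈closedN[x] G u)
    y≢u : punchIn v y′ ≢ u
    y≢u refl = x∉N[u] (adj⇒∈closedN G (trans (adj-sym G u (punchIn v x′)) xy))

  restrict-dominating : (D : Subset (suc n)) → IsStrongDominating G D → IsStrongDominating C (restrict D)
  restrict-dominating D D-dom x′ x′∉D′ =
    let y′ , y∈D , x′y′ , x′≤y′ = dominated-outside-closedN D D-dom x′ (x∉X ∘ x∈p∪q⁺ ∘ inj₁) (x∉X ∘ x∈p∪q⁺ ∘ inj₂)
    in  y′ , ∈-removeAt⁺ (D ∪ closedN G u) v (x∈p∪q⁺ (inj₁ y∈D)) , x′y′ , x′≤y′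
    where
    x∉X : punchIn v x′ ∉ D ∪ closedN G u
    x∉X = x′∉D′ ∘ ∈-removeAt⁺ (D ∪ closedN G u) v

  D∩closedN[u]-nonempty : (D : Subset (suc n)) → IsStrongDominating G D → Σ (Fin (suc n)) λ w → w ∈ D × w ∈ closedN G u
  D∩closedN[u]-nonempty D D-dom with v ∈? D
  ... | yes v∈D = v , v∈D , adj⇒∈closedN G uv
  ... | no  v∉D with D-dom v v∉D
  ...   | y , y∈D , vy , _ = u , subst (_∈ D) (neighbour-unique y vy) y∈D , x∈closedN[x] G u

  ∣restrict∣≤∣D∣+deg[u]∸1 : (D : Subset (suc n)) → IsStrongDominating G D → ∣ restrict D ∣ ≤ ∣ D ∣ + deg G u ∸ 1
  ∣restrict∣≤∣D∣+deg[u]∸1 D D-dom with D∩closedN[u]-nonempty D D-dom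
  ... | w , w∈D , w∈N[u] = ∸-monoˡ-≤ 1 (s≤s⁻¹ (begin
    suc (suc ∣ restrict D ∣)      ≡⟨ cong suc (sym (i∈p⇒∣p∣≡1+∣removeAt∣ X (x∈p∪q⁺ (inj₂ (adj⇒∈closedN G uv))))) ⟩
    suc ∣ X ∣                     ≤⟨ x∈p∩q⇒∣p∪q∣<∣p∣+∣q∣ D (closedN G u) w∈D w∈N[u] ⟩
    ∣ D ∣ + ∣ closedN G u ∣       ≤⟨ +-monoʳ-≤ ∣ D ∣ (∣closedN∣≤1+deg G u) ⟩
    ∣ D ∣ + suc (deg G u)         ≡⟨ +-suc ∣ D ∣ (deg G u) ⟩
    suc (∣ D ∣ + deg G u)         ∎))
    where
    open ≤-Reasoning
    X : Subset (suc n)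
    X = D ∪ closedN G u

  γ[G]∸1≤γ[G/v] : ∀ {k k′} → IsStrongDomNumber G k → IsStrongDomNumber C k′ → k ∸ 1 ≤ k′
  γ[G]∸1≤γ[G/v] (_ , minimal) ((D′ , D′-dom , refl) , _) =
    ∸-monoˡ-≤ 1 (≤-trans (minimal (lift D′) (lift-dominating D′ D′-dom)) (∣lift∣≤1+∣D′∣ D′))

  γ[G/v]≤γ[G]+deg[u]∸1 : ∀ {k k′} → IsStrongDomNumber G k → IsStrongDomNumber C k′ → k′ ≤ k + deg G u ∸ 1
  γ[G/v]≤γ[G]+deg[u]∸1 ((D , D-dom , refl) , _) (_ , minimal) =
    ≤-trans (minimal (restrict D) (restrict-dominating D D-dom)) (∣restrict∣≤∣D∣+deg[u]∸1 D D-dom)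

strongDominating-nonempty : (H : Graph (suc n)) (D : Subset (suc n)) → IsStrongDominating H D → 0 < ∣ D ∣
strongDominating-nonempty H D D-dom with zero ∈? D
... | yes 0∈D = x∈p⇒0<∣p∣ 0∈D
... | no  0∉D with D-dom zero 0∉D
...   | _ , y∈D , _ = x∈p⇒0<∣p∣ y∈D

dominating-singleton⇒γ≡1 : (H : Graph (suc n)) (x : Fin (suc n)) → IsStrongDominating H ⁅ x ⁆ → IsStrongDomNumber H 1
dominating-singleton⇒γ≡1 H x dom = (⁅ x ⁆ , dom , ∣⁅x⁆∣≡1 x) , strongDominating-nonempty H

1+m≡ᵇm : ∀ m → (suc m ≡ᵇ m) ≡ false
1+m≡ᵇm zero    = refl
1+m≡ᵇm (suc m) = 1+m≡ᵇm m

path : (n : ℕ) → Graph n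
path n = record
  { adj        = λ x y → (suc (toℕ x) ≡ᵇ toℕ y) ∨ (suc (toℕ y) ≡ᵇ toℕ x)
  ; adj-sym    = λ x y → ∨-comm (suc (toℕ x) ≡ᵇ toℕ y) (suc (toℕ y) ≡ᵇ toℕ x)
  ; adj-irrefl = λ x → cong₂ _∨_ (1+m≡ᵇm (toℕ x)) (1+m≡ᵇm (toℕ x))
  }

γ[P₂]≡1 : IsStrongDomNumber (path 2) 1
γ[P₂]≡1 = dominating-singleton⇒γ≡1 (path 2) zero dom
  where
  dom : IsStrongDominating (path 2) ⁅ zero ⁆
  dom zero       0∉D = contradiction here 0∉D
  dom (suc zero) _   = zero , here , refl , ≤-refl

γ[P₂/0]≡1 : IsStrongDomNumber (contract (path 2) zero) 1
γ[P₂/0]≡1 = dominating-singleton⇒γ≡1 (contract (path 2) zero) zero dom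
  where
  dom : IsStrongDominating (contract (path 2) zero) ⁅ zero ⁆
  dom zero 0∉D = contradiction here 0∉D

γ[P₄/0]≡1 : IsStrongDomNumber (contract (path 4) zero) 1
γ[P₄/0]≡1 = dominating-singleton⇒γ≡1 (contract (path 4) zero) (suc zero) dom
  where
  dom : IsStrongDominating (contract (path 4) zero) ⁅ suc zero ⁆
  dom zero             _   = suc zero , there here , refl , s≤s z≤n
  dom (suc zero)       1∉D = contradiction (there here) 1∉D
  dom (suc (suc zero)) _   = suc zero , there here , refl , s≤s z≤n

γ[P₄]≡2 : IsStrongDomNumber (path 4) 2
γ[P₄]≡2 = (inner , dom , refl) , two-ends
  where
  inner : Subset 4
  inner = outside ∷ inside ∷ inside ∷ outside ∷ []
  dom : IsStrongDominating (path 4) inner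
  dom zero                   _   = suc zero , there here , refl , s≤s z≤n
  dom (suc zero)             1∉D = contradiction (there here) 1∉D
  dom (suc (suc zero))       2∉D = contradiction (there (there here)) 2∉D
  dom (suc (suc (suc zero))) _   = suc (suc zero) , there (there here) , refl , s≤s z≤n

  first-end : ∀ D → IsStrongDominating (path 4) D → zero ∈ D ⊎ suc zero ∈ D
  first-end D D-dom with zero ∈? D
  ... | yes 0∈D = inj₁ 0∈D
  ... | no  0∉D with D-dom zero 0∉D
  ...   | suc zero             , 1∈D , _  , _ = inj₂ 1∈D
  ...   | zero                 , _   , () , _
  ...   | suc (suc zero)       , _   , () , _
  ...   | suc (suc (suc zero)) , _   , () , _

  last-end : ∀ D → IsStrongDominating (path 4) D → suc (suc (suc zero)) ∈ D ⊎ suc (suc zero) ∈ D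
  last-end D D-dom with suc (suc (suc zero)) ∈? D
  ... | yes 3∈D = inj₁ 3∈D
  ... | no  3∉D with D-dom (suc (suc (suc zero))) 3∉D
  ...   | suc (suc zero)       , 2∈D , _  , _ = inj₂ 2∈D
  ...   | zero                 , _   , () , _
  ...   | suc zero             , _   , () , _
  ...   | suc (suc (suc zero)) , _   , () , _

  two-ends : ∀ D → IsStrongDominating (path 4) D → 2 ≤ ∣ D ∣
  two-ends D D-dom with first-end D D-dom | last-end D D-dom
  ... | inj₁ a∈D | inj₁ b∈D = x∈p∧y∈p∧x≢y⇒1<∣p∣ a∈D b∈D (λ ())
  ... | inj₁ a∈D | inj₂ b∈D = x∈p∧y∈p∧x≢y⇒1<∣p∣ a∈D b∈D (λ ())
  ... | inj₂ a∈D | inj₁ b∈D = x∈p∧y∈p∧x≢y⇒1<∣p∣ a∈D b∈D (λ ())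
  ... | inj₂ a∈D | inj₂ b∈D = x∈p∧y∈p∧x≢y⇒1<∣p∣ a∈D b∈D (λ ())

theorem3 :
    (∀ {n} (G : Graph (suc n)) (v u : Fin (suc n)) →
      deg G v ≡ 1 → adj G u v ≡ true →
      ∀ (k k′ : ℕ) → IsStrongDomNumber G k → IsStrongDomNumber (contract G v) k′ →
      (k ∸ 1 ≤ k′) × (k′ ≤ k + deg G u ∸ 1))
    × (Σ ℕ λ n → Σ (Graph (suc n)) λ G → Σ (Fin (suc n)) λ v → Σ (Fin (suc n)) λ u →
        Σ ℕ λ k → Σ ℕ λ k′ →
        deg G v ≡ 1 × adj G u v ≡ true × IsStrongDomNumber G k
        × IsStrongDomNumber (contract G v) k′ × k′ ≡ k ∸ 1)
    × (Σ ℕ λ n → Σ (Graph (suc n)) λ G → Σ (Fin (suc n)) λ v → Σ (Fin (suc n)) λ u →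
        Σ ℕ λ k → Σ ℕ λ k′ →
        deg G v ≡ 1 × adj G u v ≡ true × IsStrongDomNumber G k
        × IsStrongDomNumber (contract G v) k′ × k′ ≡ k + deg G u ∸ 1)
theorem3 =
  (λ G v u deg[v]≡1 uv k k′ γ[G] γ[G/v] →
     let open Pendant G v u deg[v]≡1 uv
     in  γ[G]∸1≤γ[G/v] γ[G] γ[G/v] , γ[G/v]≤γ[G]+deg[u]∸1 γ[G] γ[G/v]) ,
  (3 , path 4 , zero , suc zero , 2 , 1 , refl , refl , γ[P₄]≡2 , γ[P₄/0]≡1 , refl) ,
  (1 , path 2 , zero , suc zero , 1 , 1 , refl , refl , γ[P₂]≡1 , γ[P₂/0]≡1 , refl)
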